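{- For $n\ge 2$, the path $P_n$ with $n$ vertices satisfies $\nu^*(P_n)=2n^2-2n-1$.
   Context: For a finite simple graph $G=(V,E)$ with $p=|V|$, $q=|E|$, $\ell=p+q$, a construction sequence (c-sequence) for $G$ is a bijection $x:\{1,\dots,\ell\}\to V\sqcup E$ such that for every edge $e=uw$, $x^{ -1}(e)>\max\{x^{ -1}(u),x^{ -1}(w)\}$. The cost of an edge $e=uw$ in $x$ is $\nu(e,x)=(x^{ -1}(e)-x^{ -1}(u))+(x^{ -1}(e)-x^{ -1}(w))$, and the cost of $x$ is $\nu(x)=\sum_{e\in E}\nu(e,x)$. The max cost of $G$ is $\nu^*(G)=\max\nu(x)$ over all c-sequences $x$ for $G$. -}

module Defs where

open import Data.Nat using (ℕ; zero; suc; _+_; _∸_; _≤_; _<_)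
open import Data.Fin using (Fin; toℕ; inject₁)
open import Data.Fin.Properties using (toℕ-inject₁; toℕ-injective)
open import Data.Nat.Properties using (n<1+n; n≤1+n; ≤-trans; <-irrefl; suc-injective)
open import Data.Product using (_×_; _,_; proj₁; proj₂; ∃)
open import Data.Product using (swap)
open import Data.Sum using (_⊎_; inj₁; inj₂)
open import Data.Empty using (⊥; ⊥-elim)
import Data.Fin as Fin
open import Data.Vec.Functional using (foldr)
open import Relation.Binary.PropositionalEquality
open import Function.Bundles using (_↔_; Inverse)

record SimpleGraph : Set where
  field
    p : ℕ
    q : ℕ
    ends : Fin q → Fin p × Fin p
    loopless : ∀ e → proj₁ (ends e) ≡ proj₂ (ends e) → ⊥
    noMulti : ∀ e f → (ends e ≡ ends f ⊎ ends e ≡ swap (ends f)) → e ≡ f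

open SimpleGraph public

Elem : SimpleGraph → Set
Elem G = Fin (p G) ⊎ Fin (q G)

-- A bijection x : {1..ℓ} → V ⊔ E. We index positions by Fin ℓ = {0..ℓ-1};
-- all costs are differences of positions, so the shift by 1 is irrelevant.
-- Inverse.to is x, Inverse.from is x⁻¹.
Bij : SimpleGraph → Set
Bij G = Fin (p G + q G) ↔ Elem G

pos : (G : SimpleGraph) → Bij G → Elem G → ℕ
pos G x a = toℕ (Inverse.from x a)

IsCSeq : (G : SimpleGraph) → Bij G → Set
IsCSeq G x = ∀ e → pos G x (inj₁ (proj₁ (ends G e))) < pos G x (inj₂ e)
                 × pos G x (inj₁ (proj₂ (ends G e))) < pos G x (inj₂ e)

-- ν(e,x) (truncated subtraction is exact for c-sequences)
edgeCost : (G : SimpleGraph) → Bij G → Fin (q G) → ℕ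
edgeCost G x e = (pos G x (inj₂ e) ∸ pos G x (inj₁ (proj₁ (ends G e))))
               + (pos G x (inj₂ e) ∸ pos G x (inj₁ (proj₂ (ends G e))))

cost : (G : SimpleGraph) → Bij G → ℕ
cost G x = foldr _+_ 0 (edgeCost G x)

MaxCostIs : SimpleGraph → ℕ → Set
MaxCostIs G N = (∃ λ (x : Bij G) → IsCSeq G x × cost G x ≡ N)
              × (∀ (x : Bij G) → IsCSeq G x → cost G x ≤ N)

private
  pathLoopless : ∀ {m} (i : Fin m) → (inject₁ i , Fin.suc i) .proj₁ ≡ (inject₁ i , Fin.suc i) .proj₂ → ⊥
  pathLoopless i eq = <-irrefl (trans (sym (toℕ-inject₁ i)) (cong toℕ eq)) (n<1+n (toℕ i))

  pathNoMulti : ∀ {m} (i j : Fin m) →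
    ((inject₁ i , Fin.suc i) ≡ (inject₁ j , Fin.suc j) ⊎
     (inject₁ i , Fin.suc i) ≡ swap (inject₁ j , Fin.suc j)) → i ≡ j
  pathNoMulti i j (inj₁ eq) = toℕ-injective (suc-injective (cong (λ z → toℕ (proj₂ z)) eq))
  pathNoMulti i j (inj₂ eq) = ⊥-elim (<-irrefl contra (≤-trans (n<1+n (toℕ i)) (n≤1+n (suc (toℕ i)))))
    where
      e1 : toℕ i ≡ suc (toℕ j)
      e1 = trans (sym (toℕ-inject₁ i)) (cong (λ z → toℕ (proj₁ z)) eq)
      e2 : suc (toℕ i) ≡ toℕ j
      e2 = trans (cong (λ z → toℕ (proj₂ z)) eq) (toℕ-inject₁ j)
      contra : toℕ i ≡ suc (suc (toℕ i))
      contra = trans e1 (cong suc (sym e2))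

path : ℕ → SimpleGraph
path zero = record { p = 0 ; q = 0 ; ends = λ () ; loopless = λ () ; noMulti = λ () }
path (suc m) = record
  { p = suc m
  ; q = m
  ; ends = λ i → inject₁ i , Fin.suc i
  ; loopless = pathLoopless
  ; noMulti = pathNoMulti
  }

-- Write ν for the cost, V and E for the sums of the positions of the vertices and of the
-- edges, and T = 0 + 1 + ⋯ + (ℓ - 1) = V + E. Each edge contributes twice its own position
-- minus the positions of its endpoints, and every vertex of P_n is an endpoint of two edges
-- except the two ends a and b, so ν = 2E - 2V + a + b. Writing I for the sum over the inner
-- vertices (V = a + I + b) this is ν = 2T - 3V - I. The n vertex positions and the n - 2
-- inner ones are distinct naturals, so V ≥ n(n-1)/2 and I ≥ (n-2)(n-3)/2, which gives
-- ν ≤ 2n² - 2n - 1; equality holds when the vertices come first, the two ends last among them.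
module Submission where

open import Defs
open import Data.Nat
open import Data.Nat.Properties
open import Data.Nat.Tactic.RingSolver using (solve-∀)
open import Data.Fin as Fin using (Fin; toℕ; inject₁; fromℕ; punchIn; splitAt)
import Data.Fin.Properties as Finₚ
open import Data.Fin.Permutation as Perm using (Permutation; _⟨$⟩ˡ_)
open import Data.Product using (_,_; proj₁; proj₂; ∃)
open import Data.Sum using (_⊎_; inj₁; inj₂; map₁)
open import Data.Sum.Properties using (inj₁-injective)
open import Data.Empty using (⊥-elim)
open import Function.Base using (_∘_)
open import Function.Bundles using (Inverse)
open import Function.Definitions using (Injective)
open import Function.Properties.Inverse using (↔-trans; ↔-sym; ↔-refl)
open import Data.Sum.Function.Propositional using (_⊎-↔_)
open import Relation.Nullary using (yes; no)
open import Relation.Nullary.Decidable using (dec-false)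
open import Relation.Binary.PropositionalEquality
open import Algebra.Properties.CommutativeMonoid.Sum +-0-commutativeMonoid
  using (sum; sum-cong-≗; ∑-distrib-+; sum-init-last; sum-remove; sum-permute)

sum-splitAt : ∀ m n (f : Fin m ⊎ Fin n → ℕ) →
              sum (f ∘ splitAt m) ≡ sum (f ∘ inj₁) + sum (f ∘ inj₂)
sum-splitAt zero    n f = refl
sum-splitAt (suc m) n f = begin
  f (inj₁ Fin.zero) + sum (f ∘ map₁ Fin.suc ∘ splitAt m)
    ≡⟨ cong (f (inj₁ Fin.zero) +_) (sum-splitAt m n (f ∘ map₁ Fin.suc)) ⟩
  f (inj₁ Fin.zero) + (sum (f ∘ inj₁ ∘ Fin.suc) + sum (f ∘ inj₂))
    ≡⟨ +-assoc (f (inj₁ Fin.zero)) _ _ ⟨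
  sum (f ∘ inj₁) + sum (f ∘ inj₂)
    ∎
  where open ≡-Reasoning

sum-toℕ : ∀ m → 2 * sum {m} toℕ + m ≡ m * m
sum-toℕ zero    = refl
sum-toℕ (suc m) = begin
  2 * sum {suc m} toℕ + suc m
    ≡⟨ cong (λ s → 2 * s + suc m) (sum-init-last {m} toℕ) ⟩
  2 * (sum (toℕ ∘ inject₁ {m}) + toℕ (fromℕ m)) + suc m
    ≡⟨ cong₂ (λ s t → 2 * (s + t) + suc m)
             (sum-cong-≗ {m} Finₚ.toℕ-inject₁) (Finₚ.toℕ-fromℕ m) ⟩
  2 * (sum {m} toℕ + m) + suc m
    ≡⟨ rearrange (sum {m} toℕ) m ⟩
  (2 * sum {m} toℕ + m) + (2 * m + 1)
    ≡⟨ cong (_+ (2 * m + 1)) (sum-toℕ m) ⟩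
  m * m + (2 * m + 1)
    ≡⟨ square-suc m ⟩
  suc m * suc m
    ∎
  where
  open ≡-Reasoning
  rearrange : ∀ s m → 2 * (s + m) + suc m ≡ (2 * s + m) + (2 * m + 1)
  rearrange = solve-∀
  square-suc : ∀ m → m * m + (2 * m + 1) ≡ suc m * suc m
  square-suc = solve-∀

argmin : ∀ {m} (f : Fin (suc m) → ℕ) → ∃ λ i → ∀ j → f i ≤ f j
argmin {zero}  f = Fin.zero , λ { Fin.zero → ≤-refl }
argmin {suc m} f with argmin (f ∘ Fin.suc)
... | i , fi≤ with f Fin.zero ≤? f (Fin.suc i)
...   | yes f0≤fi = Fin.zero , λ { Fin.zero → ≤-refl ; (Fin.suc j) → ≤-trans f0≤fi (fi≤ j) }
...   | no  f0≰fi = Fin.suc i , λ { Fin.zero → <⇒≤ (≰⇒> f0≰fi) ; (Fin.suc j) → fi≤ j }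

sum-injective-≥-from : ∀ {m} c (f : Fin m → ℕ) → Injective _≡_ _≡_ f → (∀ i → c ≤ f i) →
                       m * (2 * c + m) ≤ 2 * sum f + m
sum-injective-≥-from {zero}  c f f-inj c≤f = z≤n
sum-injective-≥-from {suc m} c f f-inj c≤f with argmin f
... | i , fi≤ = begin
  suc m * (2 * c + suc m)            ≡⟨ peel m c ⟩
  m * (2 * suc c + m) + 2 * c + 1    ≤⟨ +-monoˡ-≤ 1 (+-mono-≤ rest-bound (*-monoʳ-≤ 2 (c≤f i))) ⟩
  (2 * sum rest + m) + 2 * f i + 1   ≡⟨ regroup (sum rest) m (f i) ⟩
  2 * (f i + sum rest) + suc m       ≡⟨ cong (λ s → 2 * s + suc m) (sum-remove {i = i} f) ⟨
  2 * sum f + suc m                  ∎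
  where
  open ≤-Reasoning
  rest : Fin m → ℕ
  rest = f ∘ punchIn i
  rest-inj : Injective _≡_ _≡_ rest
  rest-inj eq = Finₚ.punchIn-injective i _ _ (f-inj eq)
  suc-c≤rest : ∀ j → suc c ≤ rest j
  suc-c≤rest j with m≤n⇒m<n∨m≡n (fi≤ (punchIn i j))
  ... | inj₁ fi<rest = ≤-trans (s≤s (c≤f i)) fi<rest
  ... | inj₂ fi≡rest = ⊥-elim (Finₚ.punchInᵢ≢i i j (sym (f-inj fi≡rest)))
  rest-bound : m * (2 * suc c + m) ≤ 2 * sum rest + m
  rest-bound = sum-injective-≥-from (suc c) rest rest-inj suc-c≤rest
  peel : ∀ m c → suc m * (2 * c + suc m) ≡ m * (2 * suc c + m) + 2 * c + 1
  peel = solve-∀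
  regroup : ∀ s m x → (2 * s + m) + 2 * x + 1 ≡ 2 * (x + s) + suc m
  regroup = solve-∀

sum-injective-≥ : ∀ {m} (f : Fin m → ℕ) → Injective _≡_ _≡_ f → m * m ≤ 2 * sum f + m
sum-injective-≥ {m} f f-inj =
  subst (_≤ 2 * sum f + m) (cong (m *_) (+-identityˡ m))
        (sum-injective-≥-from 0 f f-inj (λ _ → z≤n))

module _ (G : SimpleGraph) (x : Bij G) where

  sum-pos : sum (pos G x ∘ inj₁) + sum (pos G x ∘ inj₂) ≡ sum {p G + q G} toℕ
  sum-pos = begin
    sum (pos G x ∘ inj₁) + sum (pos G x ∘ inj₂)  ≡⟨ sum-splitAt (p G) (q G) (pos G x) ⟨
    sum (pos G x ∘ splitAt (p G))                ≡⟨ sum-permute (toℕ {p G + q G}) (↔-trans Finₚ.+↔⊎ (↔-sym x)) ⟨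
    sum {p G + q G} toℕ                          ∎
    where open ≡-Reasoning

  pos-injective : Injective _≡_ _≡_ (pos G x)
  pos-injective {a} {b} eq = begin
    a                  ≡⟨ strictlyInverseˡ a ⟨
    to (from a)        ≡⟨ cong to (Finₚ.toℕ-injective eq) ⟩
    to (from b)        ≡⟨ strictlyInverseˡ b ⟩
    b                  ∎
    where
    open ≡-Reasoning
    open Inverse x using (to; from; strictlyInverseˡ)

  endpointPos : Fin (q G) → ℕ
  endpointPos e = pos G x (inj₁ (proj₁ (ends G e))) + pos G x (inj₁ (proj₂ (ends G e)))

  cost+endpointPos : IsCSeq G x →
                     cost G x + sum endpointPos ≡ sum (pos G x ∘ inj₂) + sum (pos G x ∘ inj₂)
  cost+endpointPos cseq = begin
    cost G x + sum endpointPos                        ≡⟨ ∑-distrib-+ (edgeCost G x) endpointPos ⟨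
    sum (λ e → edgeCost G x e + endpointPos e)        ≡⟨ sum-cong-≗ edge ⟩
    sum (λ e → pos G x (inj₂ e) + pos G x (inj₂ e))   ≡⟨ ∑-distrib-+ (pos G x ∘ inj₂) (pos G x ∘ inj₂) ⟩
    sum (pos G x ∘ inj₂) + sum (pos G x ∘ inj₂)       ∎
    where
    open ≡-Reasoning
    regroup : ∀ d d′ u w → (d + d′) + (u + w) ≡ (d + u) + (d′ + w)
    regroup = solve-∀
    edge : ∀ e → edgeCost G x e + endpointPos e ≡ pos G x (inj₂ e) + pos G x (inj₂ e)
    edge e = trans (regroup (pos G x (inj₂ e) ∸ u) (pos G x (inj₂ e) ∸ w) u w)
                   (cong₂ _+_ (m∸n+n≡m (<⇒≤ (proj₁ (cseq e)))) (m∸n+n≡m (<⇒≤ (proj₂ (cseq e)))))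
      where
      u = pos G x (inj₁ (proj₁ (ends G e)))
      w = pos G x (inj₁ (proj₂ (ends G e)))

module _ (G : SimpleGraph) (σ : Permutation (p G) (p G)) where

  verticesFirst : Bij G
  verticesFirst = ↔-trans Finₚ.+↔⊎ (σ ⊎-↔ ↔-refl)

  pos-verticesFirst-vertex : ∀ v → pos G verticesFirst (inj₁ v) ≡ toℕ (σ ⟨$⟩ˡ v)
  pos-verticesFirst-vertex v = Finₚ.toℕ-↑ˡ (σ ⟨$⟩ˡ v) (q G)

  pos-verticesFirst-edge : ∀ e → pos G verticesFirst (inj₂ e) ≡ p G + toℕ e
  pos-verticesFirst-edge e = Finₚ.toℕ-↑ʳ (p G) e

  verticesFirst-isCSeq : IsCSeq G verticesFirst
  verticesFirst-isCSeq e = before (proj₁ (ends G e)) , before (proj₂ (ends G e))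
    where
    before : ∀ v → pos G verticesFirst (inj₁ v) < pos G verticesFirst (inj₂ e)
    before v = begin-strict
      pos G verticesFirst (inj₁ v)  ≡⟨ pos-verticesFirst-vertex v ⟩
      toℕ (σ ⟨$⟩ˡ v)                <⟨ Finₚ.toℕ<n (σ ⟨$⟩ˡ v) ⟩
      p G                           ≤⟨ m≤m+n (p G) (toℕ e) ⟩
      p G + toℕ e                   ≡⟨ pos-verticesFirst-edge e ⟨
      pos G verticesFirst (inj₂ e)  ∎
      where open ≤-Reasoning

≤-from-+-≡ : ∀ {a b x y} → a + x ≡ b + y → y ≤ x → a ≤ b
≤-from-+-≡ {a} {b} {x} {y} eq y≤x = +-cancelʳ-≤ y a b (begin
  a + y  ≤⟨ +-monoʳ-≤ a y≤x ⟩
  a + x  ≡⟨ eq ⟩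
  b + y  ∎)
  where open ≤-Reasoning

maxCost : ℕ → ℕ
maxCost k = 2 * k * k + 6 * k + 3

maxCost-path : ∀ k → 2 * (2 + k) * (2 + k) ∸ 2 * (2 + k) ∸ 1 ≡ maxCost k
maxCost-path k = begin
  2 * n * n ∸ 2 * n ∸ 1                ≡⟨ cong (λ m → m ∸ 2 * n ∸ 1) (expand k) ⟩
  2 * n + (1 + maxCost k) ∸ 2 * n ∸ 1  ≡⟨ cong (_∸ 1) (m+n∸m≡n (2 * n) (1 + maxCost k)) ⟩
  maxCost k                            ∎
  where
  open ≡-Reasoning
  n = 2 + k
  expand : ∀ k → 2 * (2 + k) * (2 + k) ≡ 2 * (2 + k) + (1 + (2 * k * k + 6 * k + 3))
  expand = solve-∀

-- For P_(k+2), with ℓ = 2k + 3 elements, the identities ν + 3V + I = 2T and 2T + ℓ = ℓ²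
-- make 2ν + 3(2V + n) + (2I + k) constant; sum-injective-≥ bounds 2V + n and 2I + k.
cost-balance : ∀ k c V I T → let n = 2 + k ; ℓ = n + suc k in
               c + 3 * V + I ≡ 2 * T → 2 * T + ℓ ≡ ℓ * ℓ →
               2 * c + (3 * (2 * V + n) + (2 * I + k)) ≡ 2 * maxCost k + (3 * (n * n) + k * k)
cost-balance k c V I T identity triangle = +-cancelʳ-≡ (2 * ℓ) _ _ (begin
  2 * c + (3 * (2 * V + n) + (2 * I + k)) + 2 * ℓ  ≡⟨ regroup c V I n k ℓ ⟩
  2 * (c + 3 * V + I) + 2 * ℓ + 3 * n + k          ≡⟨ cong (λ m → 2 * m + 2 * ℓ + 3 * n + k) identity ⟩
  2 * (2 * T) + 2 * ℓ + 3 * n + k                  ≡⟨ cong (λ m → m + 3 * n + k) (double T ℓ) ⟩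
  2 * (2 * T + ℓ) + 3 * n + k                      ≡⟨ cong (λ m → 2 * m + 3 * n + k) triangle ⟩
  2 * (ℓ * ℓ) + 3 * n + k                          ≡⟨ expand k ⟩
  2 * maxCost k + (3 * (n * n) + k * k) + 2 * ℓ    ∎)
  where
  open ≡-Reasoning
  n = 2 + k
  ℓ = n + suc k
  regroup : ∀ c V I n k ℓ → 2 * c + (3 * (2 * V + n) + (2 * I + k)) + 2 * ℓ
                            ≡ 2 * (c + 3 * V + I) + 2 * ℓ + 3 * n + k
  regroup = solve-∀
  double : ∀ T ℓ → 2 * (2 * T) + 2 * ℓ ≡ 2 * (2 * T + ℓ)
  double = solve-∀
  expand : ∀ k → 2 * ((2 + k + suc k) * (2 + k + suc k)) + 3 * (2 + k) + k
                 ≡ 2 * (2 * k * k + 6 * k + 3) + (3 * ((2 + k) * (2 + k)) + k * k) + 2 * (2 + k + suc k)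
  expand = solve-∀

module PathPositions (k : ℕ) (x : Bij (path (2 + k))) where

  private
    G = path (2 + k)
    n = 2 + k

  vertexPos : Fin n → ℕ
  vertexPos v = pos G x (inj₁ v)

  vertexPos-injective : Injective _≡_ _≡_ vertexPos
  vertexPos-injective eq = inj₁-injective (pos-injective G x eq)

  V E a b I : ℕ
  V = sum vertexPos
  E = sum (pos G x ∘ inj₂)
  a = vertexPos Fin.zero
  b = vertexPos (fromℕ (suc k))
  I = sum (vertexPos ∘ Fin.suc ∘ inject₁)

  V≡a+I+b : V ≡ a + (I + b)
  V≡a+I+b = cong (a +_) (sum-init-last (vertexPos ∘ Fin.suc))

  degree-sum : sum (endpointPos G x) + (a + b) ≡ V + V
  degree-sum = begin
    sum (endpointPos G x) + (a + b)   ≡⟨ cong (_+ (a + b)) (∑-distrib-+ (vertexPos ∘ inject₁) (vertexPos ∘ Fin.suc)) ⟩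
    (left + right) + (a + b)          ≡⟨ regroup left right a b ⟩
    (left + b) + (a + right)          ≡⟨ cong (_+ V) (sum-init-last vertexPos) ⟨
    V + V                             ∎
    where
    open ≡-Reasoning
    left = sum (vertexPos ∘ inject₁)
    right = sum (vertexPos ∘ Fin.suc)
    regroup : ∀ l r a b → (l + r) + (a + b) ≡ (l + b) + (a + r)
    regroup = solve-∀

  endpointPos≡V+I : sum (endpointPos G x) ≡ V + I
  endpointPos≡V+I = +-cancelʳ-≡ (a + b) _ _ (begin
    sum (endpointPos G x) + (a + b)  ≡⟨ degree-sum ⟩
    V + V                            ≡⟨ cong (V +_) V≡a+I+b ⟩
    V + (a + (I + b))                ≡⟨ regroup V a I b ⟩
    V + I + (a + b)                  ∎)
    where
    open ≡-Reasoning
    regroup : ∀ V a I b → V + (a + (I + b)) ≡ V + I + (a + b)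
    regroup = solve-∀

  cost+3V+I≡2T : IsCSeq G x → cost G x + 3 * V + I ≡ 2 * sum {n + suc k} toℕ
  cost+3V+I≡2T cseq = begin
    cost G x + 3 * V + I                          ≡⟨ regroup (cost G x) V I ⟩
    (cost G x + (V + I)) + (V + V)                ≡⟨ cong (λ m → (cost G x + m) + (V + V)) endpointPos≡V+I ⟨
    (cost G x + sum (endpointPos G x)) + (V + V)  ≡⟨ cong (_+ (V + V)) (cost+endpointPos G x cseq) ⟩
    (E + E) + (V + V)                             ≡⟨ collect E V ⟩
    2 * (V + E)                                   ≡⟨ cong (2 *_) (sum-pos G x) ⟩
    2 * sum {n + suc k} toℕ                       ∎
    where
    open ≡-Reasoning
    regroup : ∀ c V I → c + 3 * V + I ≡ (c + (V + I)) + (V + V)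
    regroup = solve-∀
    collect : ∀ E V → (E + E) + (V + V) ≡ 2 * (V + E)
    collect = solve-∀

  balance : IsCSeq G x →
            2 * cost G x + (3 * (2 * V + n) + (2 * I + k)) ≡ 2 * maxCost k + (3 * (n * n) + k * k)
  balance cseq = cost-balance k (cost G x) V I (sum {n + suc k} toℕ)
                               (cost+3V+I≡2T cseq) (sum-toℕ (n + suc k))

  cost-≤-maxCost : IsCSeq G x → cost G x ≤ maxCost k
  cost-≤-maxCost cseq = *-cancelˡ-≤ 2 (≤-from-+-≡ (balance cseq) (+-mono-≤ V-bound I-bound))
    where
    inner-injective : Injective _≡_ _≡_ (vertexPos ∘ Fin.suc ∘ inject₁)
    inner-injective = Finₚ.inject₁-injective ∘ Finₚ.suc-injective ∘ vertexPos-injective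
    V-bound : 3 * (n * n) ≤ 3 * (2 * V + n)
    V-bound = *-monoʳ-≤ 3 (sum-injective-≥ vertexPos vertexPos-injective)
    I-bound : k * k ≤ 2 * I + k
    I-bound = sum-injective-≥ (vertexPos ∘ Fin.suc ∘ inject₁) inner-injective

  cost-≡-maxCost : IsCSeq G x → 2 * V + n ≡ n * n → a ≡ k → b ≡ suc k → cost G x ≡ maxCost k
  cost-≡-maxCost cseq V-exact a≡k b≡suc-k =
    *-cancelˡ-≡ (cost G x) (maxCost k) 2 (+-cancelʳ-≡ _ _ _ (begin
      2 * cost G x + (3 * (n * n) + k * k)            ≡⟨ cong (λ m → 2 * cost G x + (3 * m + k * k)) V-exact ⟨
      2 * cost G x + (3 * (2 * V + n) + k * k)        ≡⟨ cong (λ m → 2 * cost G x + (3 * (2 * V + n) + m)) I-exact ⟨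
      2 * cost G x + (3 * (2 * V + n) + (2 * I + k))  ≡⟨ balance cseq ⟩
      2 * maxCost k + (3 * (n * n) + k * k)           ∎))
    where
    open ≡-Reasoning
    ends-last : V ≡ k + (I + suc k)
    ends-last = trans V≡a+I+b (cong₂ (λ a b → a + (I + b)) a≡k b≡suc-k)
    I-exact : 2 * I + k ≡ k * k
    I-exact = +-cancelʳ-≡ (4 * k + 4) _ _ (begin
      2 * I + k + (4 * k + 4)      ≡⟨ unfold-V k I ⟩
      2 * (k + (I + suc k)) + n    ≡⟨ cong (λ m → 2 * m + n) ends-last ⟨
      2 * V + n                    ≡⟨ V-exact ⟩
      n * n                        ≡⟨ square k ⟩
      k * k + (4 * k + 4)          ∎)
      where
      unfold-V : ∀ k I → 2 * I + k + (4 * k + 4) ≡ 2 * (k + (I + suc k)) + (2 + k)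
      unfold-V = solve-∀
      square : ∀ k → (2 + k) * (2 + k) ≡ k * k + (4 * k + 4)
      square = solve-∀

module Extremal (k : ℕ) where

  private
    G = path (2 + k)
    n = 2 + k

  -- The inner vertices 1, …, k take the positions 0, …, k - 1 and the ends 0 and k + 1
  -- the positions k and k + 1.
  σ : Permutation n n
  σ = Perm.transpose (inject₁ (fromℕ k)) Fin.zero

  x : Bij G
  x = verticesFirst G σ

  x-isCSeq : IsCSeq G x
  x-isCSeq = verticesFirst-isCSeq G σ

  open PathPositions k x

  V-exact : 2 * V + n ≡ n * n
  V-exact = begin
    2 * V + n                      ≡⟨ cong (λ s → 2 * s + n) (sum-cong-≗ (pos-verticesFirst-vertex G σ)) ⟩
    2 * sum (toℕ ∘ (σ ⟨$⟩ˡ_)) + n  ≡⟨ cong (λ s → 2 * s + n) (sum-permute toℕ (Perm.flip σ)) ⟨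
    2 * sum {n} toℕ + n            ≡⟨ sum-toℕ n ⟩
    n * n                          ∎
    where open ≡-Reasoning

  a≡k : a ≡ k
  a≡k = begin
    a                          ≡⟨ pos-verticesFirst-vertex G σ Fin.zero ⟩
    toℕ (inject₁ (fromℕ k))    ≡⟨ Finₚ.toℕ-inject₁ (fromℕ k) ⟩
    toℕ (fromℕ k)              ≡⟨ Finₚ.toℕ-fromℕ k ⟩
    k                          ∎
    where open ≡-Reasoning

  b≡suc-k : b ≡ suc k
  b≡suc-k = begin
    b                          ≡⟨ pos-verticesFirst-vertex G σ (fromℕ (suc k)) ⟩
    toℕ (σ ⟨$⟩ˡ fromℕ (suc k)) ≡⟨ cong toℕ fixed ⟩
    toℕ (fromℕ (suc k))        ≡⟨ Finₚ.toℕ-fromℕ (suc k) ⟩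
    suc k                      ∎
    where
    open ≡-Reasoning
    fixed : σ ⟨$⟩ˡ fromℕ (suc k) ≡ fromℕ (suc k)
    fixed rewrite dec-false (fromℕ (suc k) Fin.≟ inject₁ (fromℕ k)) Finₚ.fromℕ≢inject₁ = refl

  cost-x : cost G x ≡ maxCost k
  cost-x = cost-≡-maxCost x-isCSeq V-exact a≡k b≡suc-k

theorem3 : ∀ (n : ℕ) → 2 ≤ n → MaxCostIs (path n) (2 * n * n ∸ 2 * n ∸ 1)
theorem3 (suc (suc k)) (s≤s (s≤s z≤n)) rewrite maxCost-path k =
  (Extremal.x k , Extremal.x-isCSeq k , Extremal.cost-x k) ,
  λ x cseq → PathPositions.cost-≤-maxCost k x cseq
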